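{- Let $K$ be a commutative ring with unity and let $w\in A^*$ be a word with $l^*(w)=0$ (with $l^*$ computed over $K$). Then $|alph(w)|\le \lceil |w|/2\rceil$.
   Context: $A$ is a finite alphabet, $alph(w)$ the set of letters occurring in $w$, $|w|$ its length. $K\langle A\rangle$ is the free associative algebra over $K$ with scalar product $(P,Q)=\sum_u(P,u)(Q,u)$. The left normed Lie bracketing $l$: $l(\epsilon)=0$, $l(a)=a$, $l(ua)=l(u)a-a\,l(u)$, extended linearly; $l^*$ is the linear endomorphism with $(l^*(u),v)=(l(v),u)$ for all words $u,v$ (equivalently $l^*(\epsilon)=0$, $l^*(a)=a$, $l^*(aub)=l^*(au)b-l^*(ub)a$ for letters $a,b$). -}

module Defs where

open import Level using (Level)
open import Algebra.Bundles using (CommutativeRing)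
open import Data.Nat using (ℕ)
open import Data.Fin using (Fin)
open import Data.Fin.Properties using (_≟_)
open import Data.List using (List; []; _∷_; _++_; [_]; map; foldr; length; deduplicate)
open import Data.List.Properties using (≡-dec)
open import Data.Product using (_×_; _,_)
open import Relation.Nullary using (yes; no)

Word : ℕ → Set
Word k = List (Fin k)

alphSize : {k : ℕ} → Word k → ℕ
alphSize w = length (deduplicate _≟_ w)

module Poly {c ℓ : Level} (K : CommutativeRing c ℓ) (k : ℕ) where
  open CommutativeRing K

  -- A noncommutative polynomial in K⟨A⟩, as a formal finite sum of terms c·u.
  Pol : Set c
  Pol = List (Carrier × Word k)

  coeff : Pol → Word k → Carrier
  coeff [] v = 0#
  coeff ((x , u) ∷ P) v with ≡-dec _≟_ u v
  ... | yes _ = x + coeff P v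
  ... | no  _ = coeff P v

  _·ʳ_ : Pol → Fin k → Pol
  P ·ʳ a = map (λ { (x , u) → (x , u ++ [ a ]) }) P

  _·ˡ_ : Fin k → Pol → Pol
  a ·ˡ P = map (λ { (x , u) → (x , a ∷ u) }) P

  negP : Pol → Pol
  negP P = map (λ { (x , u) → (- x , u) }) P

  -- left-normed Lie bracketing: l(ε)=0, l(a)=a, l(ua) = l(u)a − a l(u)
  lgo : Pol → Word k → Pol
  lgo P [] = P
  lgo P (b ∷ rest) = lgo ((P ·ʳ b) ++ negP (b ·ˡ P)) rest

  l : Word k → Pol
  l [] = []
  l (a ∷ rest) = lgo [ (1# , [ a ]) ] rest

  -- l* is defined by (l*(u), v) = (l(v), u) for all words u, v.
  lstarCoeff : Word k → Word k → Carrier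
  lstarCoeff u v = coeff (l v) u

  LStarZero : Word k → Set ℓ
  LStarZero u = ∀ v → lstarCoeff u v ≈ 0#

module Submission where

open import Defs
open import Algebra.Bundles using (CommutativeRing)
open import Data.Nat using (ℕ; _≤_; _<_; s≤s; ⌈_/2⌉)
open import Data.Nat.Properties using (≤-refl; ≤-trans; n<1+n; m<n⇒m<1+n)
open import Data.Fin using (Fin)
open import Data.Fin.Properties using (_≟_)
open import Data.List using ([]; _∷_; _++_; [_]; _∷ʳ_; length; reverse)
open import Data.List.Properties using (++-assoc)
open import Data.List.Reverse using (Reverse; reverseView; []; _∶_∶ʳ_)
open import Data.List.Membership.Propositional using (_∈_; _∉_)
open import Data.List.Membership.Propositional.Properties using (∈-++⁺ˡ; ∈-++⁺ʳ; ∈-++⁻)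
import Data.List.Membership.DecPropositional as DecMembership
open import Data.List.Relation.Unary.Any using (here; there)
open import Data.Product using (_,_)
open import Data.Sum using (inj₁; inj₂)
open import Function using (_∘_)
open import Relation.Nullary using (yes; no; ¬_; contradiction)
open import Relation.Binary.PropositionalEquality as ≡ using (_≡_; _≢_)

-- Write (l(v), w) for the coefficient of w in l(v), so l*(w) = 0 says that all of them vanish.
-- The recursion l(v c) = l(v) c − c l(v) gives three closure properties of {w | l*(w) = 0}:
-- (i) the first letter of w occurs again, since otherwise (l(w), w) = 1 ≠ 0;
-- (ii) if w = a w' b with b ≠ a, then l*(w' b) = 0;
-- (iii) if w = X z Y where z occurs once in w and some letter of Y does not occur in X, then
--      l*(Y) = 0, since (l(u z X̃), X z Y) = ± (l(u), Y) for the reversal X̃ of X.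
-- These alone give 2 |alph(w)| ≤ |w| + 1 by induction on |w|, counting |alph(w)| as
-- Σ_c min(1, |w|_c).  If the end letters of w differ, drop the first one.  Otherwise w = a m a; cut
-- w = X x Q at the first letter x of m occurring once in w.  Either x is the only letter occurring
-- once, so every other letter is counted at least twice, or (iii) removes X x: the letters of X
-- missing from Q occur twice in X, and a lies in both X and Q, so X x adds at most (|X| + 1)/2
-- letters.

module Counting where

  open import Data.Nat using (zero; suc; _+_; _⊓_; z≤n; s≤s⁻¹) renaming (_≟_ to _≟ℕ_)
  open import Data.Nat.Properties
    using ( ≤-reflexive; +-mono-≤; +-monoʳ-≤; +-assoc; +-suc; +-identityʳ; m≤n+m; m⊓n≤m
          ; n≤1+n; n>0⇒n≢0; suc-injective; ≮⇒≥; n≤0⇒n≡0; m+n≡0⇒m≡0; m+n≡0⇒n≡0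
          ; n≡⌊n+n/2⌋; ⌊n/2⌋-mono; +-0-commutativeMonoid; module ≤-Reasoning )
  open import Data.Nat.Induction using (<-wellFounded)
  open import Algebra.Properties.CommutativeMonoid.Sum +-0-commutativeMonoid
    using (sum-syntax; sum-cong-≗; ∑-distrib-+; sum-replicate-zero)
  open import Data.Bool using (if_then_else_)
  open import Data.Fin using (zero; suc)
  open import Data.List using (deduplicate)
  open import Data.List.Properties using (length-++)
  open import Data.List.Membership.Propositional using (find)
  open import Data.List.Membership.Propositional.Properties using (∈-deduplicate⁻)
  open import Data.List.Relation.Unary.All using (all?; lookup)
  open import Data.List.Relation.Unary.All.Properties using (¬All⇒Any¬)
  open import Data.List.Relation.Unary.AllPairs using ([]; _∷_)
  import Data.List.Relation.Unary.First as First
  open import Data.List.Relation.Unary.First.Properties using (toView)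
  open import Data.List.Relation.Unary.Unique.Propositional using (Unique)
  import Data.List.Relation.Unary.Unique.DecPropositional.Properties as Unique
  open import Data.Product using (_×_)
  open import Data.Sum using (swap)
  open import Function using (case_of_)
  open import Induction.WellFounded using (Acc; acc)
  open import Relation.Nullary using (does)
  open import Relation.Nullary.Decidable using (dec-true; dec-false; toSum)

  δ : ∀ {n} → Fin n → Fin n → ℕ
  δ c x = if does (c ≟ x) then 1 else 0

  δ-refl : ∀ {n} (c : Fin n) → δ c c ≡ 1
  δ-refl c rewrite dec-true (c ≟ c) ≡.refl = ≡.refl

  δ-≢ : ∀ {n} {c x : Fin n} → c ≢ x → δ c x ≡ 0
  δ-≢ {c = c} {x} c≢x rewrite dec-false (c ≟ x) c≢x = ≡.refl

  ∑-δ : ∀ {n} (x : Fin n) → ∑[ c < n ] δ c x ≡ 1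
  ∑-δ {suc n} zero    = ≡.cong suc (sum-replicate-zero n)
  ∑-δ {suc n} (suc x) = ∑-δ x

  ∑-mono-≤ : ∀ {n} {f g : Fin n → ℕ} → (∀ i → f i ≤ g i) → ∑[ i < n ] f i ≤ ∑[ i < n ] g i
  ∑-mono-≤ {zero}  f≤g = z≤n
  ∑-mono-≤ {suc n} f≤g = +-mono-≤ (f≤g zero) (∑-mono-≤ (f≤g ∘ suc))

  1⊓n≡1 : ∀ {n} → 0 < n → 1 ⊓ n ≡ 1
  1⊓n≡1 {suc n} _ = ≡.refl

  m≤1⊓n : ∀ {m n} → m ≤ 1 → (0 < m → 0 < n) → m ≤ 1 ⊓ n
  m≤1⊓n {zero}     _       _       = z≤n
  m≤1⊓n {suc zero} _       m>0⇒n>0 = ≤-reflexive (≡.sym (1⊓n≡1 (m>0⇒n>0 (s≤s z≤n))))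
  m≤1⊓n {suc (suc m)} (s≤s ()) _

  1⊓n+1⊓n≤1+n : ∀ n → 1 ⊓ n + 1 ⊓ n ≤ suc n
  1⊓n+1⊓n≤1+n zero          = z≤n
  1⊓n+1⊓n≤1+n (suc zero)    = ≤-refl
  1⊓n+1⊓n≤1+n (suc (suc n)) = s≤s (s≤s z≤n)

  1⊓n+1⊓n≤n : ∀ n → (0 < n → n ≢ 1) → 1 ⊓ n + 1 ⊓ n ≤ n
  1⊓n+1⊓n≤n zero          _   = z≤n
  1⊓n+1⊓n≤n (suc zero)    n≢1 = contradiction ≡.refl (n≢1 (s≤s z≤n))
  1⊓n+1⊓n≤n (suc (suc n)) _   = s≤s (s≤s z≤n)

  m+m≤1+n⇒m≤⌈n/2⌉ : ∀ {m n} → m + m ≤ suc n → m ≤ ⌈ n /2⌉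
  m+m≤1+n⇒m≤⌈n/2⌉ {m} m+m≤1+n = ≤-trans (≤-reflexive (n≡⌊n+n/2⌋ m)) (⌊n/2⌋-mono m+m≤1+n)

  module _ {k : ℕ} where

    open DecMembership (_≟_ {k}) using (_∈?_)

    count : Fin k → Word k → ℕ
    count c []      = 0
    count c (x ∷ w) = δ c x + count c w

    count-++ : ∀ c u v → count c (u ++ v) ≡ count c u + count c v
    count-++ c []      v = ≡.refl
    count-++ c (x ∷ u) v =
      ≡.trans (≡.cong (δ c x +_) (count-++ c u v)) (≡.sym (+-assoc (δ c x) _ _))

    ∈⇒count>0 : ∀ {c w} → c ∈ w → 0 < count c w
    ∈⇒count>0 {c} {x ∷ w} (here ≡.refl) rewrite δ-refl c = s≤s z≤n
    ∈⇒count>0 {c} {x ∷ w} (there c∈w)   = ≤-trans (∈⇒count>0 c∈w) (m≤n+m _ (δ c x))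

    count>0⇒∈ : ∀ {c w} → 0 < count c w → c ∈ w
    count>0⇒∈ {c} {x ∷ w} count>0 with c ≟ x
    ... | yes c≡x = here c≡x
    ... | no  _   = there (count>0⇒∈ count>0)

    ∉⇒count≡0 : ∀ {c w} → c ∉ w → count c w ≡ 0
    ∉⇒count≡0 c∉w = n≤0⇒n≡0 (≮⇒≥ (c∉w ∘ count>0⇒∈))

    δ≤count : ∀ {a w} c → a ∈ w → δ c a ≤ count c w
    δ≤count {a} c a∈w with c ≟ a
    ... | yes ≡.refl = ∈⇒count>0 a∈w
    ... | no  _      = z≤n

    ∈⇒count-∷≢1 : ∀ {a w} → a ∈ w → count a (a ∷ w) ≢ 1
    ∈⇒count-∷≢1 {a} a∈w count≡1 rewrite δ-refl a =
      n>0⇒n≢0 (∈⇒count>0 a∈w) (suc-injective count≡1)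

    count-++-∷-∉ : ∀ {c X x Q} → c ≢ x → c ∉ Q → count c (X ++ x ∷ Q) ≡ count c X
    count-++-∷-∉ {c} {X} {x} {Q} c≢x c∉Q
      rewrite count-++ c X (x ∷ Q) | δ-≢ c≢x | ∉⇒count≡0 c∉Q = +-identityʳ (count c X)

    count≡1⇒∉ : ∀ {x X Q} → count x (X ++ x ∷ Q) ≡ 1 → x ∉ X × x ∉ Q
    count≡1⇒∉ {x} {X} {Q} count≡1 =
      (λ x∈X → n>0⇒n≢0 (∈⇒count>0 x∈X) (m+n≡0⇒m≡0 (count x X) outside≡0)) ,
      (λ x∈Q → n>0⇒n≢0 (∈⇒count>0 x∈Q) (m+n≡0⇒n≡0 (count x X) outside≡0))
      where
      open ≡.≡-Reasoning
      outside≡0 : count x X + count x Q ≡ 0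
      outside≡0 = suc-injective (begin
        suc (count x X + count x Q)      ≡⟨ +-suc (count x X) (count x Q) ⟨
        count x X + (1 + count x Q)      ≡⟨ ≡.cong (λ d → count x X + (d + count x Q)) (δ-refl x) ⟨
        count x X + (δ x x + count x Q)  ≡⟨ count-++ x X (x ∷ Q) ⟨
        count x (X ++ x ∷ Q)             ≡⟨ count≡1 ⟩
        1                                ∎)

    length≡∑count : ∀ w → length w ≡ ∑[ c < k ] count c w
    length≡∑count []      = ≡.sym (sum-replicate-zero k)
    length≡∑count (x ∷ w) = ≡.trans (≡.cong₂ _+_ (≡.sym (∑-δ x)) (length≡∑count w))
                                    (≡.sym (∑-distrib-+ (λ c → δ c x) (λ c → count c w)))

    Unique⇒count≤1 : ∀ {u} → Unique u → ∀ c → count c u ≤ 1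
    Unique⇒count≤1         []           c = z≤n
    Unique⇒count≤1 {x ∷ u} (x∉u ∷ !u) c with c ≟ x
    ... | yes ≡.refl rewrite ∉⇒count≡0 {c} {u} (λ c∈u → lookup x∉u c∈u ≡.refl) = ≤-refl
    ... | no  _      = Unique⇒count≤1 !u c

    distinct : Word k → ℕ
    distinct w = ∑[ c < k ] (1 ⊓ count c w)

    alphSize≤distinct : ∀ w → alphSize w ≤ distinct w
    alphSize≤distinct w = ≤-trans (≤-reflexive (length≡∑count dedup)) (∑-mono-≤ λ c →
      m≤1⊓n (Unique⇒count≤1 (Unique.deduplicate-! _≟_ w) c)
            (∈⇒count>0 ∘ ∈-deduplicate⁻ _≟_ w ∘ count>0⇒∈ {c} {dedup}))
      where
      dedup = deduplicate _≟_ w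

    distinct-∷-∈ : ∀ {a w} → a ∈ w → distinct (a ∷ w) ≡ distinct w
    distinct-∷-∈ {a} {w} a∈w = sum-cong-≗ pointwise
      where
      pointwise : ∀ c → 1 ⊓ count c (a ∷ w) ≡ 1 ⊓ count c w
      pointwise c with c ≟ a
      ... | yes ≡.refl = ≡.sym (1⊓n≡1 (∈⇒count>0 a∈w))
      ... | no  _      = ≡.refl

    AlphabetBound : Word k → Set
    AlphabetBound w = distinct w + distinct w ≤ suc (length w)

    alphabetBound-[] : AlphabetBound []
    alphabetBound-[] rewrite sum-replicate-zero k = z≤n

    alphabetBound-∷-∈ : ∀ {a w} → a ∈ w → AlphabetBound w → AlphabetBound (a ∷ w)
    alphabetBound-∷-∈ a∈w bound rewrite distinct-∷-∈ a∈w = ≤-trans bound (n≤1+n _)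

    alphabetBound-repeated : ∀ {w} x → (∀ c → c ∈ w → c ≢ x → count c w ≢ 1) → AlphabetBound w
    alphabetBound-repeated {w} x repeated = begin
      distinct w + distinct w
        ≡⟨ ∑-distrib-+ (λ c → 1 ⊓ count c w) (λ c → 1 ⊓ count c w) ⟨
      ∑[ c < k ] (1 ⊓ count c w + 1 ⊓ count c w)
        ≤⟨ ∑-mono-≤ pointwise ⟩
      ∑[ c < k ] (δ c x + count c w)
        ≡⟨ ∑-distrib-+ (λ c → δ c x) (λ c → count c w) ⟩
      ∑[ c < k ] δ c x + ∑[ c < k ] count c w
        ≡⟨ ≡.cong₂ _+_ (∑-δ x) (≡.sym (length≡∑count w)) ⟩
      suc (length w) ∎
      where
      open ≤-Reasoning
      pointwise : ∀ c → 1 ⊓ count c w + 1 ⊓ count c w ≤ δ c x + count c w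
      pointwise c with c ≟ x
      ... | yes _   = 1⊓n+1⊓n≤1+n (count c w)
      ... | no  c≢x = 1⊓n+1⊓n≤n (count c w) λ count>0 → repeated c (count>0⇒∈ count>0) c≢x

    -- The extra δ c a on the left, paid for by a ∈ X, is what improves |X x Q| + 2 to |X x Q| + 1.
    alphabetBound-++-∷ : ∀ {X x Q a} → x ∉ X → x ∉ Q → a ∈ X → a ∈ Q →
                         (∀ c → c ∈ X → count c (X ++ x ∷ Q) ≢ 1) →
                         AlphabetBound Q → AlphabetBound (X ++ x ∷ Q)
    alphabetBound-++-∷ {X} {x} {Q} {a} x∉X x∉Q a∈X a∈Q repeated boundQ
      rewrite length-++ X {x ∷ Q} =
      s≤s⁻¹ (≤-trans sum-bound (+-monoʳ-≤ 2 (+-monoʳ-≤ (length X) boundQ)))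
      where
      open ≤-Reasoning
      w = X ++ x ∷ Q
      x≢a : x ≢ a
      x≢a ≡.refl = x∉X a∈X
      pointwise : ∀ c → δ c a + (1 ⊓ count c w + 1 ⊓ count c w)
                      ≤ (δ c x + δ c x) + (count c X + (1 ⊓ count c Q + 1 ⊓ count c Q))
      pointwise c rewrite count-++ c X (x ∷ Q) with c ≟ x
      ... | yes ≡.refl rewrite ∉⇒count≡0 x∉X | ∉⇒count≡0 x∉Q | δ-≢ x≢a = ≤-refl
      ... | no  c≢x with c ∈? Q
      ...   | yes c∈Q rewrite 1⊓n≡1 (∈⇒count>0 c∈Q) =
        +-mono-≤ (δ≤count c a∈X) (+-mono-≤ (m⊓n≤m 1 (count c X + count c Q))
                                             (m⊓n≤m 1 (count c X + count c Q)))
      ...   | no  c∉Q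
        rewrite ∉⇒count≡0 c∉Q | δ-≢ {c = c} {a} (λ { ≡.refl → c∉Q a∈Q }) | +-identityʳ (count c X) =
        1⊓n+1⊓n≤n (count c X) λ count>0 →
          repeated c (count>0⇒∈ count>0) ∘ ≡.trans (count-++-∷-∉ {X = X} c≢x c∉Q)
      two≡ : ∑[ c < k ] (δ c x + δ c x) ≡ 2
      two≡ = ≡.trans (∑-distrib-+ (λ c → δ c x) (λ c → δ c x)) (≡.cong₂ _+_ (∑-δ x) (∑-δ x))
      X+Q≡ : ∑[ c < k ] (count c X + (1 ⊓ count c Q + 1 ⊓ count c Q))
           ≡ length X + (distinct Q + distinct Q)
      X+Q≡ = ≡.trans (∑-distrib-+ (λ c → count c X) (λ c → 1 ⊓ count c Q + 1 ⊓ count c Q))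
                     (≡.cong₂ _+_ (≡.sym (length≡∑count X))
                                  (∑-distrib-+ (λ c → 1 ⊓ count c Q) (λ c → 1 ⊓ count c Q)))
      sum-bound : suc (distinct w + distinct w) ≤ 2 + (length X + (distinct Q + distinct Q))
      sum-bound = begin
        suc (distinct w + distinct w)
          ≡⟨ ≡.cong₂ _+_ (∑-δ a) (∑-distrib-+ (λ c → 1 ⊓ count c w) (λ c → 1 ⊓ count c w)) ⟨
        ∑[ c < k ] δ c a + ∑[ c < k ] (1 ⊓ count c w + 1 ⊓ count c w)
          ≡⟨ ∑-distrib-+ (λ c → δ c a) (λ c → 1 ⊓ count c w + 1 ⊓ count c w) ⟨
        ∑[ c < k ] (δ c a + (1 ⊓ count c w + 1 ⊓ count c w))
          ≤⟨ ∑-mono-≤ pointwise ⟩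
        ∑[ c < k ] ((δ c x + δ c x) + (count c X + (1 ⊓ count c Q + 1 ⊓ count c Q)))
          ≡⟨ ∑-distrib-+ (λ c → δ c x + δ c x)
                         (λ c → count c X + (1 ⊓ count c Q + 1 ⊓ count c Q)) ⟩
        ∑[ c < k ] (δ c x + δ c x) + ∑[ c < k ] (count c X + (1 ⊓ count c Q + 1 ⊓ count c Q))
          ≡⟨ ≡.cong₂ _+_ two≡ X+Q≡ ⟩
        2 + (length X + (distinct Q + distinct Q)) ∎

    module _ {ℓ} (Z : Word k → Set ℓ)
      (head-repeats : ∀ {a w} → Z (a ∷ w) → a ∈ w)
      (drop-head : ∀ {a w b} → b ≢ a → Z (a ∷ w ∷ʳ b) → Z (w ∷ʳ b))
      (drop-block : ∀ {X z Y y} → z ∉ X → z ∉ Y → y ∈ Y → y ∉ X → Z (X ++ z ∷ Y) → Z Y)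
      where

      ShorterBounded : ℕ → Set ℓ
      ShorterBounded n = ∀ v → length v < n → Z v → AlphabetBound v

      -- Either x is the only letter occurring once, or a letter of Q outside X lets drop-block
      -- cut off X x.
      alphabetBound-split : ∀ {w X x Q a} → w ≡ X ++ x ∷ Q → ShorterBounded (length w) → Z w →
                            x ∉ X → x ∉ Q → a ∈ X → a ∈ Q → (∀ c → c ∈ X → count c w ≢ 1) →
                            AlphabetBound w
      alphabetBound-split {X = X} {x} {Q} ≡.refl ih z x∉X x∉Q a∈X a∈Q repeated with all? (_∈? X) Q
      ... | yes Q⊆X = alphabetBound-repeated x λ c c∈w c≢x → case ∈-++⁻ X c∈w of λ where
        (inj₁ c∈X)         → repeated c c∈X
        (inj₂ (here c≡x))  → contradiction c≡x c≢x
        (inj₂ (there c∈Q)) → repeated c (lookup Q⊆X c∈Q)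
      ... | no  Q⊈X with find (¬All⇒Any¬ (_∈? X) Q Q⊈X)
      ...   | y , y∈Q , y∉X =
        alphabetBound-++-∷ x∉X x∉Q a∈X a∈Q repeated
          (ih Q Q-shorter (drop-block x∉X x∉Q y∈Q y∉X z))
        where
        Q-shorter : length Q < length (X ++ x ∷ Q)
        Q-shorter = ≡.subst (length Q <_) (≡.sym (length-++ X)) (m≤n+m (suc (length Q)) (length X))

      -- Cut a m a at the first letter x of m occurring exactly once; then a lies on both sides of x.
      alphabetBound-closed : ∀ a m → ShorterBounded (length (a ∷ m ∷ʳ a)) → Z (a ∷ m ∷ʳ a) →
                             AlphabetBound (a ∷ m ∷ʳ a)
      alphabetBound-closed a m ih z
        with First.first (λ c → swap (toSum (count c (a ∷ m ∷ʳ a) ≟ℕ 1))) m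
      ... | inj₂ none-once = alphabetBound-repeated a λ where
          c (here ≡.refl)  _ → a-repeated
          c (there c∈m∷ʳa) _ → case ∈-++⁻ m c∈m∷ʳa of λ where
            (inj₁ c∈m)           → lookup none-once c∈m
            (inj₂ (here ≡.refl)) → a-repeated
        where
        a-repeated : count a (a ∷ m ∷ʳ a) ≢ 1
        a-repeated = ∈⇒count-∷≢1 (∈-++⁺ʳ m (here ≡.refl))
      ... | inj₁ found with toView found
      ...   | First._++_∷_ {X} {x} X-repeated x-once Q =
        let x∉aX , x∉Qa = count≡1⇒∉ {x} {a ∷ X} {Q ∷ʳ a}
                             (≡.trans (≡.cong (count x) (≡.sym reassoc)) x-once)
        in alphabetBound-split reassoc ih z x∉aX x∉Qa (here ≡.refl) (∈-++⁺ʳ Q (here ≡.refl)) λ where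
            c (here ≡.refl) → ∈⇒count-∷≢1 (∈-++⁺ʳ (X ++ x ∷ Q) (here ≡.refl))
            c (there c∈X)   → lookup X-repeated c∈X
        where
        reassoc : a ∷ (X ++ x ∷ Q) ∷ʳ a ≡ (a ∷ X) ++ x ∷ (Q ∷ʳ a)
        reassoc = ≡.cong (a ∷_) (++-assoc X (x ∷ Q) [ a ])

      alphabetBound-acc : ∀ w → Acc _<_ (length w) → Z w → AlphabetBound w
      alphabetBound-acc []      _         _ = alphabetBound-[]
      alphabetBound-acc (a ∷ w) (acc rec) z with reverseView w | head-repeats z
      ... | []         | ()
      ... | m ∶ _ ∶ʳ b | a∈w with b ≟ a
      ...   | no  b≢a    =
        alphabetBound-∷-∈ a∈w (alphabetBound-acc (m ∷ʳ b) (rec ≤-refl) (drop-head b≢a z))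
      ...   | yes ≡.refl = alphabetBound-closed a m (λ v v< → alphabetBound-acc v (rec v<)) z

      alphabetBound : ∀ w → Z w → AlphabetBound w
      alphabetBound w = alphabetBound-acc w (<-wellFounded (length w))

module Brackets {c ℓ} (K : CommutativeRing c ℓ) (k : ℕ) where

  open import Data.List using (map)
  open import Data.List.Properties
    using (≡-dec; ∷-injective; ∷ʳ-injectiveˡ; ∷ʳ-injectiveʳ; unfold-reverse)
  open import Data.Product using (proj₁; proj₂; map₂)
  open import Function.Definitions using (Injective)
  open CommutativeRing K
  open Poly K k
  open import Algebra.Properties.AbelianGroup +-abelianGroup
    using (⁻¹-∙-comm; ε⁻¹≈ε; x∙y⁻¹≈ε⇒x≈y; x≈y⇒x∙y⁻¹≈ε)
  open import Relation.Binary.Reasoning.Setoid setoid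
  open DecMembership (_≟_ {k}) using (_∈?_)

  coeff-∷-≡ : ∀ x u P → coeff ((x , u) ∷ P) u ≈ x + coeff P u
  coeff-∷-≡ x u P with ≡-dec _≟_ u u
  ... | yes _   = refl
  ... | no  u≢u = contradiction ≡.refl u≢u

  coeff-++ : ∀ P Q v → coeff (P ++ Q) v ≈ coeff P v + coeff Q v
  coeff-++ []            Q v = sym (+-identityˡ _)
  coeff-++ ((x , u) ∷ P) Q v with ≡-dec _≟_ u v
  ... | yes _ = trans (+-congˡ (coeff-++ P Q v)) (sym (+-assoc _ _ _))
  ... | no  _ = coeff-++ P Q v

  coeff-negP : ∀ P v → coeff (negP P) v ≈ - coeff P v
  coeff-negP []            v = sym ε⁻¹≈ε
  coeff-negP ((x , u) ∷ P) v with ≡-dec _≟_ u v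
  ... | yes _ = trans (+-congˡ (coeff-negP P v)) (⁻¹-∙-comm x (coeff P v))
  ... | no  _ = coeff-negP P v

  coeff-map-injective : ∀ {f : Word k → Word k} → Injective _≡_ _≡_ f →
                        ∀ P v → coeff (map (map₂ f) P) (f v) ≈ coeff P v
  coeff-map-injective         f-inj []            v = refl
  coeff-map-injective {f = f} f-inj ((x , u) ∷ P) v with ≡-dec _≟_ (f u) (f v) | ≡-dec _≟_ u v
  ... | yes _     | yes _   = +-congˡ (coeff-map-injective f-inj P v)
  ... | no  _     | no  _   = coeff-map-injective f-inj P v
  ... | yes fu≡fv | no  u≢v = contradiction (f-inj fu≡fv) u≢v
  ... | no  fu≢fv | yes u≡v = contradiction (≡.cong f u≡v) fu≢fv

  coeff-map-∉-image : ∀ {f : Word k → Word k} {v} → (∀ u → f u ≢ v) →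
                      ∀ P → coeff (map (map₂ f) P) v ≈ 0#
  coeff-map-∉-image         v∉im []            = refl
  coeff-map-∉-image {f = f} {v} v∉im ((x , u) ∷ P) with ≡-dec _≟_ (f u) v
  ... | yes fu≡v = contradiction fu≡v (v∉im u)
  ... | no  _    = coeff-map-∉-image v∉im P

  coeff-·ʳ : ∀ P a L M → coeff (P ·ʳ a) (L ++ M ∷ʳ a) ≈ coeff P (L ++ M)
  coeff-·ʳ P a L M = trans (reflexive (≡.cong (coeff (P ·ʳ a)) (≡.sym (++-assoc L M [ a ]))))
                           (coeff-map-injective (∷ʳ-injectiveˡ _ _) P (L ++ M))

  coeff-·ʳ-≢ : ∀ P {a b} L M → a ≢ b → coeff (P ·ʳ a) (L ++ M ∷ʳ b) ≈ 0#
  coeff-·ʳ-≢ P {a} {b} L M a≢b =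
    trans (reflexive (≡.cong (coeff (P ·ʳ a)) (≡.sym (++-assoc L M [ b ]))))
          (coeff-map-∉-image (λ u → a≢b ∘ ∷ʳ-injectiveʳ u (L ++ M)) P)

  coeff-·ˡ : ∀ P a v → coeff (a ·ˡ P) (a ∷ v) ≈ coeff P v
  coeff-·ˡ P a = coeff-map-injective (proj₂ ∘ ∷-injective) P

  coeff-·ˡ-≢ : ∀ P {a b} v → a ≢ b → coeff (a ·ˡ P) (b ∷ v) ≈ 0#
  coeff-·ˡ-≢ P v a≢b = coeff-map-∉-image (λ u → a≢b ∘ proj₁ ∘ ∷-injective) P

  lgo-∷ʳ : ∀ P v c → lgo P (v ∷ʳ c) ≡ (lgo P v ·ʳ c) ++ negP (c ·ˡ lgo P v)
  lgo-∷ʳ P []      c = ≡.refl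
  lgo-∷ʳ P (b ∷ v) c = lgo-∷ʳ ((P ·ʳ b) ++ negP (b ·ˡ P)) v c

  coeff-l-∷ʳ : ∀ u us c w →
               coeff (l (u ∷ us ∷ʳ c)) w ≈ coeff (l (u ∷ us) ·ʳ c) w + - coeff (c ·ˡ l (u ∷ us)) w
  coeff-l-∷ʳ u us c w rewrite lgo-∷ʳ [ (1# , [ u ]) ] us c =
    trans (coeff-++ (l (u ∷ us) ·ʳ c) _ w) (+-congˡ (coeff-negP (c ·ˡ l (u ∷ us)) w))

  coeff-l-∷ʳ≈0 : ∀ u us c w →
                 coeff (l (u ∷ us) ·ʳ c) w ≈ 0# → coeff (c ·ˡ l (u ∷ us)) w ≈ 0# →
                 coeff (l (u ∷ us ∷ʳ c)) w ≈ 0#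
  coeff-l-∷ʳ≈0 u us c w right≈0 left≈0 =
    trans (coeff-l-∷ʳ u us c w) (x≈y⇒x∙y⁻¹≈ε (trans right≈0 (sym left≈0)))

  coeff-l-∷ʳ≈0⇒·ˡ≈0 : ∀ u us c w →
                      coeff (l (u ∷ us ∷ʳ c)) w ≈ 0# → coeff (l (u ∷ us) ·ʳ c) w ≈ 0# →
                      coeff (c ·ˡ l (u ∷ us)) w ≈ 0#
  coeff-l-∷ʳ≈0⇒·ˡ≈0 u us c w total≈0 right≈0 =
    trans (sym (x∙y⁻¹≈ε⇒x≈y _ _ (trans (sym (coeff-l-∷ʳ u us c w)) total≈0))) right≈0

  coeff-l-head : ∀ z {Q} → Reverse Q → z ∉ Q → coeff (l (z ∷ Q)) (z ∷ Q) ≈ 1#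
  coeff-l-head z []             _       = trans (coeff-∷-≡ 1# [ z ] []) (+-identityʳ 1#)
  coeff-l-head z (Q ∶ rQ ∶ʳ c) z∉Q∷ʳc = begin
    coeff (l (z ∷ Q ∷ʳ c)) (z ∷ Q ∷ʳ c)
      ≈⟨ coeff-l-∷ʳ z Q c (z ∷ Q ∷ʳ c) ⟩
    coeff (l (z ∷ Q) ·ʳ c) (z ∷ Q ∷ʳ c) + - coeff (c ·ˡ l (z ∷ Q)) (z ∷ Q ∷ʳ c)
      ≈⟨ +-cong (coeff-·ʳ (l (z ∷ Q)) c [] (z ∷ Q))
                (-‿cong (coeff-·ˡ-≢ (l (z ∷ Q)) (Q ∷ʳ c) c≢z)) ⟩
    coeff (l (z ∷ Q)) (z ∷ Q) + - 0#
      ≈⟨ +-cong (coeff-l-head z rQ (z∉Q∷ʳc ∘ ∈-++⁺ˡ)) ε⁻¹≈ε ⟩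
    1# + 0#
      ≈⟨ +-identityʳ 1# ⟩
    1# ∎
    where
    c≢z : c ≢ z
    c≢z ≡.refl = z∉Q∷ʳc (∈-++⁺ʳ Q (here ≡.refl))

  bracket-∷ʳ : ∀ (us : Word k) z c R → us ++ z ∷ reverse (c ∷ R) ≡ (us ++ z ∷ reverse R) ∷ʳ c
  bracket-∷ʳ us z c R = ≡.trans (≡.cong (λ S → us ++ z ∷ S) (unfold-reverse c R))
                                (≡.sym (++-assoc us (z ∷ reverse R) [ c ]))

  ∈-∷ʳ-≢ : ∀ {y b} (Y : Word k) → y ∈ Y ∷ʳ b → y ≢ b → y ∈ Y
  ∈-∷ʳ-≢ Y y∈Y∷ʳb y≢b with ∈-++⁻ Y y∈Y∷ʳb
  ... | inj₁ y∈Y        = y∈Y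
  ... | inj₂ (here y≡b) = contradiction y≡b y≢b

  -- Peel the letters of R off the bracket from the right, each matching an end of the target: the right
  -- end never gets past y, and the left end reaches z only after all of L, which |R| < |L| forbids.
  coeff-l-vanishes : ∀ u us z {y} R L {Y} → Reverse Y → length R < length L →
                     z ∉ L → z ∉ Y → y ∈ Y → y ∉ R →
                     coeff (l (u ∷ us ++ z ∷ reverse R)) (L ++ z ∷ Y) ≈ 0#
  coeff-l-vanishes u us z R       (h ∷ L) []             _ _ _ () _
  coeff-l-vanishes u us z []      (h ∷ L) (Y ∶ _ ∶ʳ b)   _ z∉hL z∉Y∷ʳb _ _ =
    coeff-l-∷ʳ≈0 u us z (h ∷ L ++ z ∷ Y ∷ʳ b)
      (coeff-·ʳ-≢ (l (u ∷ us)) (h ∷ L) (z ∷ Y) λ { ≡.refl → z∉Y∷ʳb (∈-++⁺ʳ Y (here ≡.refl)) })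
      (coeff-·ˡ-≢ (l (u ∷ us)) (L ++ z ∷ Y ∷ʳ b) λ { ≡.refl → z∉hL (here ≡.refl) })
  coeff-l-vanishes u us z {y} (c ∷ R) (h ∷ L) rY∷ʳb@(Y ∶ rY ∶ʳ b) (s≤s |R|<|L|)
                   z∉hL z∉Y∷ʳb y∈Y∷ʳb y∉cR
    rewrite bracket-∷ʳ us z c R =
    coeff-l-∷ʳ≈0 u V c (h ∷ L ++ z ∷ Y ∷ʳ b) right left
    where
    V = us ++ z ∷ reverse R
    right : coeff (l (u ∷ V) ·ʳ c) (h ∷ L ++ z ∷ Y ∷ʳ b) ≈ 0#
    right with c ≟ b
    ... | yes ≡.refl = trans (coeff-·ʳ (l (u ∷ V)) c (h ∷ L) (z ∷ Y))
                             (coeff-l-vanishes u us z R (h ∷ L) rY (m<n⇒m<1+n |R|<|L|) z∉hL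
                                (z∉Y∷ʳb ∘ ∈-++⁺ˡ) (∈-∷ʳ-≢ Y y∈Y∷ʳb (y∉cR ∘ here)) (y∉cR ∘ there))
    ... | no  c≢b    = coeff-·ʳ-≢ (l (u ∷ V)) (h ∷ L) (z ∷ Y) c≢b
    left : coeff (c ·ˡ l (u ∷ V)) (h ∷ L ++ z ∷ Y ∷ʳ b) ≈ 0#
    left with c ≟ h
    ... | yes ≡.refl = trans (coeff-·ˡ (l (u ∷ V)) c (L ++ z ∷ Y ∷ʳ b))
                             (coeff-l-vanishes u us z R L rY∷ʳb |R|<|L| (z∉hL ∘ there) z∉Y∷ʳb y∈Y∷ʳb
                                (y∉cR ∘ there))
    ... | no  c≢h    = coeff-·ˡ-≢ (l (u ∷ V)) (L ++ z ∷ Y ∷ʳ b) c≢h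

  -- As above, peeling the last letter of P from the right leads to a vanishing coefficient, so only
  -- peeling P from the left survives, leaving ± (l(u us), Y).
  coeff-l-block : ∀ u us z {y} P {Y} → Reverse Y → z ∉ P → z ∉ Y → y ∈ Y → y ∉ P →
                  coeff (l (u ∷ us ++ z ∷ reverse P)) (P ++ z ∷ Y) ≈ 0# → coeff (l (u ∷ us)) Y ≈ 0#
  coeff-l-block u us z P       []            _ _ () _ _
  coeff-l-block u us z []      (Y ∶ _ ∶ʳ b) _ z∉Y∷ʳb _ _ total≈0 =
    trans (sym (coeff-·ˡ (l (u ∷ us)) z (Y ∷ʳ b)))
      (coeff-l-∷ʳ≈0⇒·ˡ≈0 u us z (z ∷ Y ∷ʳ b) total≈0
        (coeff-·ʳ-≢ (l (u ∷ us)) [] (z ∷ Y) λ { ≡.refl → z∉Y∷ʳb (∈-++⁺ʳ Y (here ≡.refl)) }))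
  coeff-l-block u us z {y} (p ∷ P) rY∷ʳb@(Y ∶ rY ∶ʳ b) z∉pP z∉Y∷ʳb y∈Y∷ʳb y∉pP total≈0 =
    coeff-l-block u us z P rY∷ʳb (z∉pP ∘ there) z∉Y∷ʳb y∈Y∷ʳb (y∉pP ∘ there)
      (trans (sym (coeff-·ˡ (l (u ∷ V)) p (P ++ z ∷ Y ∷ʳ b)))
        (coeff-l-∷ʳ≈0⇒·ˡ≈0 u V p (p ∷ P ++ z ∷ Y ∷ʳ b)
          (≡.subst (λ v → coeff (l (u ∷ v)) (p ∷ P ++ z ∷ Y ∷ʳ b) ≈ 0#) (bracket-∷ʳ us z p P)
                   total≈0)
          right))
    where
    V = us ++ z ∷ reverse P
    right : coeff (l (u ∷ V) ·ʳ p) (p ∷ P ++ z ∷ Y ∷ʳ b) ≈ 0#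
    right with p ≟ b
    ... | yes ≡.refl = trans (coeff-·ʳ (l (u ∷ V)) p (p ∷ P) (z ∷ Y))
                             (coeff-l-vanishes u us z P (p ∷ P) rY (n<1+n (length P)) z∉pP
                                (z∉Y∷ʳb ∘ ∈-++⁺ˡ) (∈-∷ʳ-≢ Y y∈Y∷ʳb (y∉pP ∘ here)) (y∉pP ∘ there))
    ... | no  p≢b    = coeff-·ʳ-≢ (l (u ∷ V)) (p ∷ P) (z ∷ Y) p≢b

  lstar-head-repeats : ¬ 1# ≈ 0# → ∀ {a w} → LStarZero (a ∷ w) → a ∈ w
  lstar-head-repeats 1≉0 {a} {w} l*≈0 with a ∈? w
  ... | yes a∈w = a∈w
  ... | no  a∉w =
    contradiction (trans (sym (coeff-l-head a (reverseView w) a∉w)) (l*≈0 (a ∷ w))) 1≉0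

  lstar-drop-head : ∀ {a w b} → b ≢ a → LStarZero (a ∷ w ∷ʳ b) → LStarZero (w ∷ʳ b)
  lstar-drop-head b≢a l*≈0 []       = refl
  lstar-drop-head {a} {w} {b} b≢a l*≈0 (u ∷ us) =
    trans (sym (coeff-·ˡ (l (u ∷ us)) a (w ∷ʳ b)))
      (coeff-l-∷ʳ≈0⇒·ˡ≈0 u us a (a ∷ w ∷ʳ b) (l*≈0 (u ∷ us ∷ʳ a))
        (coeff-·ʳ-≢ (l (u ∷ us)) [] (a ∷ w) (b≢a ∘ ≡.sym)))

  lstar-drop-block : ∀ {X z Y y} → z ∉ X → z ∉ Y → y ∈ Y → y ∉ X →
                     LStarZero (X ++ z ∷ Y) → LStarZero Y
  lstar-drop-block z∉X z∉Y y∈Y y∉X l*≈0 []       = refl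
  lstar-drop-block {X} {z} {Y} z∉X z∉Y y∈Y y∉X l*≈0 (u ∷ us) =
    coeff-l-block u us z X (reverseView Y) z∉X z∉Y y∈Y y∉X (l*≈0 (u ∷ us ++ z ∷ reverse X))

open Counting using (alphSize≤distinct; m+m≤1+n⇒m≤⌈n/2⌉; alphabetBound)

theorem3p3 : ∀ {c ℓ} (K : CommutativeRing c ℓ) (k : ℕ) (w : Word k)
    → ¬ (CommutativeRing._≈_ K (CommutativeRing.1# K) (CommutativeRing.0# K))
    → Poly.LStarZero K k w
    → alphSize w ≤ ⌈ length w /2⌉
theorem3p3 K k w 1≉0 l*w≈0 =
  ≤-trans (alphSize≤distinct w)
          (m+m≤1+n⇒m≤⌈n/2⌉ (alphabetBound (Poly.LStarZero K k)
            (lstar-head-repeats 1≉0) lstar-drop-head lstar-drop-block w l*w≈0))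
  where open Brackets K k
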